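{- Let $G$ be a connected finite simple unicyclic graph (i.e., containing exactly one cycle) whose unique cycle has length at least $7$, and suppose the maximum degree satisfies $\Delta(G)\geq 3$. Then $\chi_{D_L}(G)\leq \Delta(G)$.
   Context: A vertex coloring $f$ of a graph $G$ is distinguishing if the only automorphism $\phi$ of $G$ with $f(\phi(v))=f(v)$ for all vertices $v$ is the identity. A list assignment $L=\{L(v)\}_{v\in V(G)}$ assigns to each vertex a finite set of colors; $G$ is properly $L$-distinguishable if there is a proper vertex coloring $f$ of $G$ which is distinguishing and satisfies $f(v)\in L(v)$ for all $v$. The list-distinguishing chromatic number $\chi_{D_L}(G)$ is the minimum integer $k$ such that $G$ is properly $L$-distinguishable for every list assignment $L$ with $|L(v)|=k$ for all $v\in V(G)$. -}

module Defs where

open import Data.Nat using (ℕ; zero; suc; _≤_; _⊔_)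
open import Data.Fin using (Fin)
open import Data.Bool using (Bool; true; false)
open import Data.List using (List; []; _∷_; length; filter; map; foldr; allFin)
open import Data.List.Membership.Propositional using (_∈_)
open import Data.List.Relation.Unary.Unique.Propositional using (Unique)
open import Data.Product using (Σ; ∃; _×_; _,_; proj₁)
open import Data.Sum using (_⊎_)
open import Relation.Binary.PropositionalEquality using (_≡_; _≢_)
open import Relation.Nullary using (¬_)
open import Function.Bundles using (_⇔_)
open import Data.Bool.Properties using (T?)

record Graph (n : ℕ) : Set where
  field
    adj     : Fin n → Fin n → Bool
    adj-sym : ∀ u v → adj u v ≡ adj v u
    irrefl  : ∀ v → adj v v ≡ false
open Graph public

module _ {n : ℕ} (G : Graph n) where

  Adj : Fin n → Fin n → Set
  Adj u v = adj G u v ≡ true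

  data Walk : Fin n → Fin n → Set where
    [] : ∀ {v} → Walk v v
    _∷_ : ∀ {u w v} → Adj u w → Walk w v → Walk u v

  Connected : Set
  Connected = ∀ u v → Walk u v

  degree : Fin n → ℕ
  degree v = length (filter (λ u → T? (adj G v u)) (allFin n))

  maxDegree : ℕ
  maxDegree = foldr _⊔_ 0 (map degree (allFin n))

  -- CycEdge x xs v0 a b : the (cyclic) sequence x, xs..., back to v0
  -- has a and b as consecutive entries (in either order)
  data CycEdge : Fin n → List (Fin n) → Fin n → Fin n → Fin n → Set where
    here-close : ∀ {x v0} → CycEdge x [] v0 x v0
    here       : ∀ {x y ys v0} → CycEdge x (y ∷ ys) v0 x y
    there      : ∀ {x y ys v0 a b} → CycEdge y ys v0 a b → CycEdge x (y ∷ ys) v0 a b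

  record Cycle : Set where
    field
      v0    : Fin n
      vs    : List (Fin n)
      uniq  : Unique (v0 ∷ vs)
      long  : 3 ≤ length (v0 ∷ vs)
      edges : ∀ a b → CycEdge v0 vs v0 a b → Adj a b
  open Cycle public

  cycleLength : Cycle → ℕ
  cycleLength C = length (v0 C ∷ vs C)

  CycleEdge : Cycle → Fin n → Fin n → Set
  CycleEdge C a b = CycEdge (v0 C) (vs C) (v0 C) a b ⊎ CycEdge (v0 C) (vs C) (v0 C) b a

  -- two cycles are the same subgraph iff they have the same edge set
  SameCycle : Cycle → Cycle → Set
  SameCycle C D = ∀ a b → CycleEdge C a b ⇔ CycleEdge D a b

  UniqueCycle : Cycle → Set
  UniqueCycle C = ∀ D → SameCycle C D

  Unicyclic : Set
  Unicyclic = Σ Cycle UniqueCycle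

  record Automorphism : Set where
    field
      φ      : Fin n → Fin n
      φ⁻¹    : Fin n → Fin n
      inv₁   : ∀ v → φ (φ⁻¹ v) ≡ v
      inv₂   : ∀ v → φ⁻¹ (φ v) ≡ v
      pres   : ∀ u v → adj G (φ u) (φ v) ≡ adj G u v
  open Automorphism public

  Proper : (Fin n → ℕ) → Set
  Proper f = ∀ u v → Adj u v → f u ≢ f v

  Distinguishing : (Fin n → ℕ) → Set
  Distinguishing f = ∀ (σ : Automorphism) → (∀ v → f (φ σ v) ≡ f v) → ∀ v → φ σ v ≡ v

  ListAssignment : ℕ → Set
  ListAssignment k = Σ (Fin n → List ℕ) λ L → ∀ v → Unique (L v) × length (L v) ≡ k

  ProperlyLDistinguishable : (Fin n → List ℕ) → Set
  ProperlyLDistinguishable L =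
    ∃ λ (f : Fin n → ℕ) → (∀ v → f v ∈ L v) × Proper f × Distinguishing f

  AllListsWork : ℕ → Set
  AllListsWork k = ∀ (L : ListAssignment k) → ProperlyLDistinguishable (proj₁ L)

  -- χ_{D_L}(G) ≤ m  (the minimum k with AllListsWork k is ≤ m)
  χDL≤ : ℕ → Set
  χDL≤ m = ∃ λ k → k ≤ m × AllListsWork k

-- The unique cycle c 0, …, c (L - 1) is coloured first.  Position 0 gets some colour y, and every
-- other position a colour from its list avoiding y and its predecessor, except position L ∸ 3,
-- which reuses y when its list allows it and otherwise avoids its predecessor and the colour of
-- position 3.  A colour-preserving automorphism maps the unique cycle onto itself, so it acts on
-- it as a rotation or a reflection; it must send 0 to 0 or to L ∸ 3, and the unmirrored pair
-- (3, L ∸ 3) leaves only the identity.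
--
-- The remaining vertices are attached one at a time, each to exactly one vertex already reached
-- (a second neighbour would close a second cycle), and receive a colour different from their
-- parent and from their earlier siblings.  A parent u has a neighbour that is not its child, so
-- at most deg u - 1 < Δ colours are forbidden.  Once an automorphism fixes a parent it fixes
-- each child, because siblings have distinct colours.

module Submission where

open import Defs
open import Data.Nat using (ℕ; zero; suc; pred; _≤_; _<_; _∸_; _+_; _⊔_; z≤n; s≤s; _≟_)
open import Data.Nat.Properties
  using (≤-refl; ≤-trans; <-trans; <⇒≤; ≤-pred; ≤∧≢⇒<; <⇒≢; <⇒≱; <-irrefl; <-cmp; n≤1+n; 1+n≢n; n≢0⇒n>0;
         m≤m⊔n; m≤n⊔m; m≤n+m; ∸-monoˡ-≤; ∸-monoʳ-<; +-suc; +-identityʳ; module ≤-Reasoning)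
open import Data.Fin using (Fin)
import Data.Fin as Fin
import Data.Fin.Properties as Fin
open import Data.Bool using (true)
import Data.Bool as Bool
open import Data.Bool.Properties using (T?; T-≡)
open import Data.List using (List; []; _∷_; length; map; filter; foldr; _++_; allFin)
open import Data.List.Properties using (length-map; length-tabulate)
open import Data.List.Membership.Propositional using (_∈_; _∉_; find; lose)
open import Data.List.Membership.Propositional.Properties
  using (∈-map⁺; ∈-map⁻; ∈-filter⁺; ∈-filter⁻; ∈-allFin; ∈-++⁺ˡ; ∈-++⁺ʳ; ∈-++⁻)
import Data.List.Membership.DecPropositional as DecMembership
open import Data.List.Relation.Binary.Subset.Propositional using (_⊆_)
open import Data.List.Relation.Unary.Any using (Any; here; there; any?)
open import Data.List.Relation.Unary.All using (All; []; _∷_)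
import Data.List.Relation.Unary.All as All
open import Data.List.Relation.Unary.All.Properties using (¬Any⇒All¬)
open import Data.List.Relation.Unary.AllPairs using ([]; _∷_)
import Data.List.Relation.Unary.AllPairs.Properties as AllPairs
open import Data.List.Relation.Unary.Unique.Propositional using (Unique)
open import Data.List.Relation.Unary.Unique.Propositional.Properties using (Unique[x∷xs]⇒x∉xs)
import Data.List.Relation.Unary.Unique.Propositional.Properties as Unique
open import Data.Product using (∃; ∃₂; _×_; _,_; proj₁; proj₂)
open import Data.Sum using (_⊎_; inj₁; inj₂; [_,_])
open import Data.Empty using (⊥; ⊥-elim)
open import Data.Unit using (⊤; tt)
open import Function using (_∘_)
open import Function.Bundles using (Equivalence)
open import Relation.Nullary using (¬_; Dec; yes; no; ¬?; contradiction)
open import Relation.Nullary.Decidable using (decidable-stable; _×-dec_)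
open import Relation.Binary.Definitions using (DecidableEquality; tri<; tri≈; tri>)
open import Relation.Binary.PropositionalEquality
  using (_≡_; _≢_; refl; sym; trans; cong; subst; subst₂; module ≡-Reasoning)

module _ {A : Set} (_≟ᴬ_ : DecidableEquality A) where
  open DecMembership _≟ᴬ_ using (_∈?_)

  remove : A → List A → List A
  remove x [] = []
  remove x (y ∷ ys) with x ≟ᴬ y
  ... | yes _ = ys
  ... | no _ = y ∷ remove x ys

  length-remove : ∀ {x ys} → x ∈ ys → suc (length (remove x ys)) ≡ length ys
  length-remove {x} {y ∷ ys} x∈ with x ≟ᴬ y | x∈
  ... | yes _ | _ = refl
  ... | no x≢y | here x≡y = contradiction x≡y x≢y
  ... | no _ | there x∈ys = cong suc (length-remove x∈ys)

  ∈-remove⁺ : ∀ {x y ys} → y ∈ ys → y ≢ x → y ∈ remove x ys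
  ∈-remove⁺ {x} {y} {z ∷ ys} y∈ y≢x with x ≟ᴬ z | y∈
  ... | yes refl | here refl = contradiction refl y≢x
  ... | yes _ | there y∈ys = y∈ys
  ... | no _ | here y≡z = here y≡z
  ... | no _ | there y∈ys = there (∈-remove⁺ y∈ys y≢x)

  Unique-⊆⇒length≤ : ∀ {xs ys} → Unique xs → xs ⊆ ys → length xs ≤ length ys
  Unique-⊆⇒length≤ {[]} _ _ = z≤n
  Unique-⊆⇒length≤ {x ∷ xs} {ys} (x≢xs ∷ !xs) xs⊆ys = begin
    suc (length xs)             ≤⟨ s≤s (Unique-⊆⇒length≤ !xs xs⊆ys-x) ⟩
    suc (length (remove x ys))  ≡⟨ length-remove (xs⊆ys (here refl)) ⟩
    length ys                   ∎
    where
    open ≤-Reasoning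
    xs⊆ys-x : xs ⊆ remove x ys
    xs⊆ys-x y∈xs = ∈-remove⁺ (xs⊆ys (there y∈xs)) (λ y≡x → All.lookup x≢xs y∈xs (sym y≡x))

  Unique-⊆-∉⇒length< : ∀ {x xs ys} → Unique xs → xs ⊆ ys → x ∈ ys → x ∉ xs → length xs < length ys
  Unique-⊆-∉⇒length< {x} {xs} !xs xs⊆ys x∈ys x∉xs =
    Unique-⊆⇒length≤ (¬Any⇒All¬ xs x∉xs ∷ !xs) λ { (here refl) → x∈ys ; (there y∈xs) → xs⊆ys y∈xs }

  Unique⇒∃∉ : ∀ {xs avoid} → Unique xs → length avoid < length xs → Any (_∉ avoid) xs
  Unique⇒∃∉ {xs} {avoid} !xs avoid<xs with any? (λ x → ¬? (x ∈? avoid)) xs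
  ... | yes p = p
  ... | no ¬p = contradiction (Unique-⊆⇒length≤ !xs xs⊆avoid) (<⇒≱ avoid<xs)
    where
    xs⊆avoid : xs ⊆ avoid
    xs⊆avoid {x} x∈xs = decidable-stable (x ∈? avoid) (¬p ∘ lose x∈xs)

open DecMembership _≟_ using () renaming (_∈?_ to _∈ℕ?_)

-- 0 is a junk value, returned only when every entry of xs is avoided.
pick : List ℕ → List ℕ → ℕ
pick xs avoid with any? (λ x → ¬? (x ∈ℕ? avoid)) xs
... | yes p = proj₁ (find p)
... | no _ = 0

pick-spec : ∀ {xs avoid} → Unique xs → length avoid < length xs → pick xs avoid ∈ xs × pick xs avoid ∉ avoid
pick-spec {xs} {avoid} !xs avoid<xs with any? (λ x → ¬? (x ∈ℕ? avoid)) xs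
... | yes p = proj₂ (find p)
... | no ¬p = contradiction (Unique⇒∃∉ _≟_ !xs avoid<xs) ¬p

module Cyclic (L : ℕ) where

  next : ℕ → ℕ
  next i with suc i ≟ L
  ... | yes _ = 0
  ... | no _ = suc i

  prev : ℕ → ℕ
  prev zero = pred L
  prev (suc i) = i

  next-cases : ∀ {i} → i < L → (suc i < L × next i ≡ suc i) ⊎ (suc i ≡ L × next i ≡ 0)
  next-cases {i} i<L with suc i ≟ L
  ... | yes 1+i≡L = inj₂ (1+i≡L , refl)
  ... | no 1+i≢L = inj₁ (≤∧≢⇒< i<L 1+i≢L , refl)

  next≡suc : ∀ {i} → suc i < L → next i ≡ suc i
  next≡suc {i} 1+i<L with suc i ≟ L
  ... | yes 1+i≡L = contradiction 1+i≡L (<⇒≢ 1+i<L)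
  ... | no _ = refl

  next<L : ∀ {i} → i < L → next i < L
  next<L i<L with next-cases i<L
  ... | inj₁ (1+i<L , e) = subst (_< L) (sym e) 1+i<L
  ... | inj₂ (_ , e) = subst (_< L) (sym e) (≤-trans (s≤s z≤n) i<L)

  prev<L : ∀ {i} → i < L → prev i < L
  prev<L {zero} (s≤s _) = ≤-refl
  prev<L {suc i} i<L = ≤-trans (n≤1+n (suc i)) i<L

  prev-next : ∀ {i} → i < L → prev (next i) ≡ i
  prev-next i<L with next-cases i<L
  ... | inj₁ (_ , e) rewrite e = refl
  ... | inj₂ (1+i≡L , e) rewrite e = cong pred (sym 1+i≡L)

  next-prev : ∀ {i} → i < L → next (prev i) ≡ i
  next-prev {suc i} i<L = next≡suc i<L
  next-prev {zero} (s≤s {n = L-1} _) with next-cases {L-1} ≤-refl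
  ... | inj₁ (L<L , _) = contradiction L<L (<-irrefl refl)
  ... | inj₂ (_ , e) = e

  next²≢id : 3 ≤ L → ∀ {i} → i < L → next (next i) ≢ i
  next²≢id 3≤L i<L with next-cases i<L
  next²≢id 3≤L i<L | inj₂ (1+i≡L , e) rewrite e | next≡suc {0} (≤-trans (s≤s (s≤s z≤n)) 3≤L) =
    λ { refl → <-irrefl 1+i≡L (≤-trans (s≤s (s≤s (s≤s z≤n))) 3≤L) }
  next²≢id 3≤L i<L | inj₁ (1+i<L , e) rewrite e with next-cases 1+i<L
  ... | inj₁ (_ , e′) rewrite e′ = λ ()
  ... | inj₂ (2+i≡L , e′) rewrite e′ = λ { refl → <-irrefl 2+i≡L 3≤L }

  prev²≢id : 3 ≤ L → ∀ {i} → i < L → prev (prev i) ≢ i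
  prev²≢id 3≤L {i} i<L prev²i≡i = next²≢id 3≤L (prev<L (prev<L i<L)) (begin
    next (next (prev (prev i)))  ≡⟨ cong next (next-prev (prev<L i<L)) ⟩
    next (prev i)                ≡⟨ next-prev i<L ⟩
    i                            ≡⟨ sym prev²i≡i ⟩
    prev (prev i)                ∎)
    where open ≡-Reasoning

at : {A : Set} → List A → ℕ → A → A
at [] i d = d
at (x ∷ xs) zero d = x
at (x ∷ xs) (suc i) d = at xs i d

module _ {A : Set} {d : A} where

  at-∈ : ∀ {xs i} → i < length xs → at xs i d ∈ xs
  at-∈ {x ∷ xs} {zero} _ = here refl
  at-∈ {x ∷ xs} {suc i} (s≤s i<) = there (at-∈ i<)

  ∈⇒at : ∀ {xs y} → y ∈ xs → ∃ λ i → i < length xs × at xs i d ≡ y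
  ∈⇒at (here refl) = 0 , s≤s z≤n , refl
  ∈⇒at (there y∈xs) with ∈⇒at y∈xs
  ... | i , i< , e = suc i , s≤s i< , e

  at-injective : ∀ {xs} → Unique xs → ∀ {i j} → i < length xs → j < length xs → at xs i d ≡ at xs j d → i ≡ j
  at-injective {x ∷ xs} _ {zero} {zero} _ _ _ = refl
  at-injective {x ∷ xs} !xs {zero} {suc j} _ (s≤s j<) e =
    contradiction (subst (_∈ xs) (sym e) (at-∈ j<)) (Unique[x∷xs]⇒x∉xs !xs)
  at-injective {x ∷ xs} !xs {suc i} {zero} (s≤s i<) _ e =
    contradiction (subst (_∈ xs) e (at-∈ i<)) (Unique[x∷xs]⇒x∉xs !xs)
  at-injective {x ∷ xs} (_ ∷ !xs) {suc i} {suc j} (s≤s i<) (s≤s j<) e = cong suc (at-injective !xs i< j< e)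

  at-++-< : ∀ {xs w i} → i < length xs → at (xs ++ w ∷ []) i d ≡ at xs i d
  at-++-< {x ∷ xs} {i = zero} _ = refl
  at-++-< {x ∷ xs} {i = suc i} (s≤s i<) = at-++-< {xs} i<

  at-++-length : ∀ {xs w} → at (xs ++ w ∷ []) (length xs) d ≡ w
  at-++-length {[]} = refl
  at-++-length {x ∷ xs} = at-++-length {xs}

module _ {n : ℕ} {G : Graph n} where

  CycEdge⇒at : ∀ {x xs w a b} (d : Fin n) → CycEdge G x xs w a b →
               ∃ λ i → i ≤ length xs × a ≡ at (x ∷ xs) i d × b ≡ at (xs ++ w ∷ []) i d
  CycEdge⇒at d here-close = 0 , z≤n , refl , refl
  CycEdge⇒at d here = 0 , z≤n , refl , refl
  CycEdge⇒at d (there e) with CycEdge⇒at d e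
  ... | i , i≤ , a≡ , b≡ = suc i , s≤s i≤ , a≡ , b≡

  at⇒CycEdge : ∀ {x xs w} (d : Fin n) i → i ≤ length xs → CycEdge G x xs w (at (x ∷ xs) i d) (at (xs ++ w ∷ []) i d)
  at⇒CycEdge {xs = []} d zero _ = here-close
  at⇒CycEdge {xs = _ ∷ _} d zero _ = here
  at⇒CycEdge {xs = _ ∷ _} d (suc i) (s≤s i≤) = there (at⇒CycEdge d i i≤)

module OnCycle {n : ℕ} {G : Graph n} (C : Cycle G) where

  vertices : List (Fin n)
  vertices = v0 C ∷ vs C

  L : ℕ
  L = length vertices

  open Cyclic L public

  c : ℕ → Fin n
  c i = at vertices i (v0 C)

  c-injective : ∀ {i j} → i < L → j < L → c i ≡ c j → i ≡ j
  c-injective = at-injective (uniq C)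

  c∈ : ∀ {i} → i < L → c i ∈ vertices
  c∈ = at-∈

  ∈⇒c : ∀ {x} → x ∈ vertices → ∃ λ i → i < L × c i ≡ x
  ∈⇒c = ∈⇒at

  c-next : ∀ {i} → i < L → at (vs C ++ v0 C ∷ []) i (v0 C) ≡ c (next i)
  c-next {i} i<L with next-cases i<L
  ... | inj₁ (s≤s i<|vs| , e) = trans (at-++-< {xs = vs C} i<|vs|) (cong c (sym e))
  ... | inj₂ (1+i≡L , e) rewrite e | cong pred 1+i≡L = at-++-length {xs = vs C}

  cycle-edge : ∀ {i} → i < L → CycleEdge G C (c i) (c (next i))
  cycle-edge {i} i<L@(s≤s i≤) = inj₁ (subst (CycEdge G (v0 C) (vs C) (v0 C) (c i)) (c-next i<L) (at⇒CycEdge (v0 C) i i≤))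

  cycle-edge′ : ∀ {i} → i < L → CycleEdge G C (c i) (c (prev i))
  cycle-edge′ {i} i<L with cycle-edge (prev<L i<L)
  ... | inj₁ e = inj₂ (subst (CycEdge G (v0 C) (vs C) (v0 C) (c (prev i)) ∘ c) (next-prev i<L) e)
  ... | inj₂ e = inj₁ (subst (λ j → CycEdge G (v0 C) (vs C) (v0 C) (c j) (c (prev i))) (next-prev i<L) e)

  CycEdge⇒c : ∀ {a b} → CycEdge G (v0 C) (vs C) (v0 C) a b → ∃ λ i → i < L × a ≡ c i × b ≡ c (next i)
  CycEdge⇒c e with CycEdge⇒at (v0 C) e
  ... | i , i≤ , a≡ , b≡ = i , s≤s i≤ , a≡ , trans b≡ (c-next (s≤s i≤))

  cycle-edge⇒∈ : ∀ {a b} → CycleEdge G C a b → a ∈ vertices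
  cycle-edge⇒∈ (inj₁ e) with CycEdge⇒c e
  ... | i , i<L , refl , _ = c∈ i<L
  cycle-edge⇒∈ (inj₂ e) with CycEdge⇒c e
  ... | i , i<L , _ , refl = c∈ (next<L i<L)

  cycle-edge-neighbour : ∀ {i x} → i < L → CycleEdge G C (c i) x → x ≡ c (next i) ⊎ x ≡ c (prev i)
  cycle-edge-neighbour i<L (inj₁ e) with CycEdge⇒c e
  ... | j , j<L , ci≡cj , refl = inj₁ (cong (c ∘ next) (c-injective j<L i<L (sym ci≡cj)))
  cycle-edge-neighbour {i} i<L (inj₂ e) with CycEdge⇒c e
  ... | j , j<L , refl , ci≡cnj = inj₂ (cong c (begin
    j               ≡⟨ sym (prev-next j<L) ⟩
    prev (next j)   ≡⟨ cong prev (c-injective (next<L j<L) i<L (sym ci≡cnj)) ⟩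
    prev i          ∎))
    where open ≡-Reasoning

module Walks {n : ℕ} (G : Graph n) where
  open DecMembership (Fin._≟_ {n}) using () renaming (_∈?_ to _∈ⱽ?_)

  Adj-sym : ∀ {u v} → Adj G u v → Adj G v u
  Adj-sym {u} {v} uv = trans (adj-sym G v u) uv

  Adj-irrefl : ∀ {u v} → Adj G u v → u ≢ v
  Adj-irrefl {u} uu refl with trans (sym uu) (irrefl G u)
  ... | ()

  data WalkIn (P : Fin n → Set) : Fin n → Fin n → Set where
    stay : ∀ {u} → P u → WalkIn P u u
    step : ∀ {u w v} → P u → Adj G u w → WalkIn P w v → WalkIn P u v

  module _ {P : Fin n → Set} where

    WalkIn-map : ∀ {Q : Fin n → Set} → (∀ {x} → P x → Q x) → ∀ {u v} → WalkIn P u v → WalkIn Q u v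
    WalkIn-map f (stay pu) = stay (f pu)
    WalkIn-map f (step pu uw w) = step (f pu) uw (WalkIn-map f w)

    WalkIn-snoc : ∀ {u v w} → WalkIn P u v → Adj G v w → P w → WalkIn P u w
    WalkIn-snoc (stay pu) uw pw = step pu uw (stay pw)
    WalkIn-snoc (step pu uw w) vx px = step pu uw (WalkIn-snoc w vx px)

    WalkIn-reverse : ∀ {u v} → WalkIn P u v → WalkIn P v u
    WalkIn-reverse (stay pu) = stay pu
    WalkIn-reverse (step pu uw w) = WalkIn-snoc (WalkIn-reverse w) (Adj-sym uw) pu

    WalkIn-++ : ∀ {u v w} → WalkIn P u v → WalkIn P v w → WalkIn P u w
    WalkIn-++ (stay _) w′ = w′
    WalkIn-++ (step pu uw w) w′ = step pu uw (WalkIn-++ w w′)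

  data Path : Fin n → Fin n → List (Fin n) → Set where
    [] : ∀ {u} → Path u u []
    _∷_ : ∀ {u x v xs} → Adj G u x → Path x v xs → Path u v (x ∷ xs)

  record SimplePathIn (P : Fin n → Set) (u v : Fin n) : Set where
    constructor simple
    field
      {inner} : List (Fin n)
      path    : Path u v inner
      unique  : Unique (u ∷ inner)
      inside  : All P (u ∷ inner)

  module _ {P : Fin n → Set} where

    shortcut : ∀ {u w v} (p : SimplePathIn P w v) → u ∈ w ∷ SimplePathIn.inner p → SimplePathIn P u v
    shortcut p (here refl) = p
    shortcut (simple (_ ∷ p) (_ ∷ !xs) (_ ∷ Pxs)) (there u∈) = shortcut (simple p !xs Pxs) u∈

    simplify : ∀ {u v} → WalkIn P u v → SimplePathIn P u v
    simplify (stay pu) = simple [] ([] ∷ []) (pu ∷ [])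
    simplify {u} (step pu uw w) with simplify w
    ... | p@(simple {xs} path !xs Pxs) with u ∈ⱽ? (_ ∷ xs)
    ...   | yes u∈ = shortcut p u∈
    ...   | no u∉ = simple (uw ∷ path) (¬Any⇒All¬ _ u∉ ∷ !xs) (pu ∷ Pxs)

  Path-CycEdge : ∀ {u w v xs a b} → Path u w xs → Adj G w v → CycEdge G u xs v a b → Adj G a b
  Path-CycEdge [] wv here-close = wv
  Path-CycEdge (ux ∷ _) _ here = ux
  Path-CycEdge (_ ∷ p) wv (there e) = Path-CycEdge p wv e

  cycle-through : ∀ {P v u₁ u₂} → WalkIn P u₁ u₂ → ¬ P v → Adj G v u₁ → Adj G v u₂ → u₁ ≢ u₂ →
                  ∃ λ (D : Cycle G) → v ∈ OnCycle.vertices D × All (λ x → x ≡ v ⊎ P x) (OnCycle.vertices D)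
  cycle-through {P} {v} {u₁} {u₂} w ¬Pv vu₁ vu₂ u₁≢u₂ with simplify w
  ... | simple [] _ _ = contradiction refl u₁≢u₂
  ... | simple {x ∷ xs} p !xs Pxs = D , here refl , inj₁ refl ∷ All.map inj₂ Pxs
    where
    edges-D : ∀ a b → CycEdge G v (u₁ ∷ x ∷ xs) v a b → Adj G a b
    edges-D a b here = vu₁
    edges-D a b (there e) = Path-CycEdge p (Adj-sym vu₂) e
    D : Cycle G
    D = record
      { v0 = v ; vs = u₁ ∷ x ∷ xs
      ; uniq = ¬Any⇒All¬ _ (¬Pv ∘ All.lookup Pxs) ∷ !xs
      ; long = s≤s (s≤s (s≤s z≤n))
      ; edges = edges-D }

  CycleEdge⊆⇒vertices⊆ : (C D : Cycle G) → (∀ {a b} → CycleEdge G D a b → CycleEdge G C a b) →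
                         OnCycle.vertices D ⊆ OnCycle.vertices C
  CycleEdge⊆⇒vertices⊆ C D D⊆C x∈D with OnCycle.∈⇒c D x∈D
  ... | i , i<L , refl = OnCycle.cycle-edge⇒∈ C (D⊆C (OnCycle.cycle-edge D i<L))

  unique-cycle-through : ∀ (C : Cycle G) {P v u₁ u₂} → UniqueCycle G C →
                         WalkIn P u₁ u₂ → ¬ P v → Adj G v u₁ → Adj G v u₂ → u₁ ≢ u₂ →
                         v ∈ OnCycle.vertices C × All (λ x → x ≡ v ⊎ P x) (OnCycle.vertices C)
  unique-cycle-through C uc w ¬Pv vu₁ vu₂ u₁≢u₂ with cycle-through w ¬Pv vu₁ vu₂ u₁≢u₂
  ... | D , v∈D , D⊆ =
    CycleEdge⊆⇒vertices⊆ C D (Equivalence.from (uc D _ _)) v∈D ,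
    All.tabulate (All.lookup D⊆ ∘ CycleEdge⊆⇒vertices⊆ D C (Equivalence.to (uc D _ _)))

module _ {n : ℕ} {G : Graph n} where

  φ-injective : (σ : Automorphism G) → ∀ {x y} → φ σ x ≡ φ σ y → x ≡ y
  φ-injective σ {x} {y} e = trans (sym (inv₂ σ x)) (trans (cong (φ⁻¹ σ) e) (inv₂ σ y))

  CycEdge-map : ∀ (f : Fin n → Fin n) {x xs w a b} → CycEdge G x xs w a b → CycEdge G (f x) (map f xs) (f w) (f a) (f b)
  CycEdge-map f here-close = here-close
  CycEdge-map f here = here
  CycEdge-map f (there e) = there (CycEdge-map f e)

  CycEdge-unmap : ∀ (f : Fin n → Fin n) {x xs w a b} → CycEdge G (f x) (map f xs) (f w) a b →
                  ∃₂ λ a′ b′ → a ≡ f a′ × b ≡ f b′ × CycEdge G x xs w a′ b′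
  CycEdge-unmap f {xs = []} here-close = _ , _ , refl , refl , here-close
  CycEdge-unmap f {xs = _ ∷ _} here = _ , _ , refl , refl , here
  CycEdge-unmap f {xs = _ ∷ _} (there e) with CycEdge-unmap f e
  ... | a′ , b′ , refl , refl , e′ = a′ , b′ , refl , refl , there e′

  image-cycle : Automorphism G → Cycle G → Cycle G
  image-cycle σ C = record
    { v0 = φ σ (v0 C)
    ; vs = map (φ σ) (vs C)
    ; uniq = Unique.map⁺ (φ-injective σ) (uniq C)
    ; long = subst (3 ≤_) (cong suc (sym (length-map (φ σ) (vs C)))) (long C)
    ; edges = edges-image }
    where
    edges-image : ∀ a b → CycEdge G (φ σ (v0 C)) (map (φ σ) (vs C)) (φ σ (v0 C)) a b → Adj G a b
    edges-image a b e with CycEdge-unmap (φ σ) e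
    ... | a′ , b′ , refl , refl , e′ = trans (pres σ a′ b′) (edges C a′ b′ e′)

  automorphism-preserves-unique-cycle : ∀ (C : Cycle G) → UniqueCycle G C → (σ : Automorphism G) →
                                        ∀ {a b} → CycleEdge G C a b → CycleEdge G C (φ σ a) (φ σ b)
  automorphism-preserves-unique-cycle C uc σ {a} {b} e =
    Equivalence.from (uc (image-cycle σ C) (φ σ a) (φ σ b)) ([ inj₁ ∘ CycEdge-map (φ σ) , inj₂ ∘ CycEdge-map (φ σ) ] e)

module OnUniqueCycle {n : ℕ} {G : Graph n} (C : Cycle G) (uc : UniqueCycle G C) where
  open OnCycle C
  open Walks G

  CycleEdge⇒Adj : ∀ {a b} → CycleEdge G C a b → Adj G a b
  CycleEdge⇒Adj (inj₁ e) = edges C _ _ e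
  CycleEdge⇒Adj (inj₂ e) = Adj-sym (edges C _ _ e)

  Adj-c-suc : ∀ {k} → suc k < L → Adj G (c k) (c (suc k))
  Adj-c-suc {k} 1+k<L = subst (Adj G (c k) ∘ c) (next≡suc 1+k<L) (CycleEdge⇒Adj (cycle-edge (<⇒≤ 1+k<L)))

  InArc : ℕ → ℕ → Fin n → Set
  InArc j i x = ∃ λ m → j ≤ m × m < i × c m ≡ x

  arc-walk : ∀ {j i} k → j ≤ k → k < i → i ≤ L → WalkIn (InArc j i) (c j) (c k)
  arc-walk {j} k j≤k k<i i≤L with j ≟ k
  arc-walk k _ k<i _ | yes refl = stay (k , ≤-refl , k<i , refl)
  arc-walk zero z≤n _ _ | no 0≢0 = contradiction refl 0≢0
  arc-walk (suc k) j≤1+k 1+k<i i≤L | no j≢1+k =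
    WalkIn-snoc (arc-walk k (≤-pred (≤∧≢⇒< j≤1+k j≢1+k)) (<⇒≤ 1+k<i) i≤L)
                (Adj-c-suc (≤-trans 1+k<i i≤L)) (suc k , j≤1+k , 1+k<i , refl)

  chord-below : ∀ {i j} → j < i → i < L → Adj G (c i) (c j) → j ≡ prev i ⊎ j ≡ next i
  chord-below {suc i} {j} (s≤s j≤i) 1+i<L ci~cj with j ≟ i
  ... | yes refl = inj₁ refl
  ... | no j≢i = [ outside-0 , outside-last ] (j-cases j)
    where
    i<L = <⇒≤ 1+i<L
    j<i = ≤∧≢⇒< j≤i j≢i
    c-arc : All (λ x → x ≡ c (suc i) ⊎ InArc j (suc i) x) vertices
    c-arc = proj₂ (unique-cycle-through C uc (arc-walk i j≤i ≤-refl (<⇒≤ 1+i<L))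
      (λ { (m , _ , m<1+i , cm≡) → <⇒≢ m<1+i (c-injective (<-trans m<1+i 1+i<L) 1+i<L cm≡) })
      ci~cj (Adj-sym (Adj-c-suc 1+i<L)) (<⇒≢ j<i ∘ c-injective (<-trans j<i i<L) i<L))
    outside : ∀ {m} → m < L → m ≢ suc i → (∀ {m′} → j ≤ m′ → m′ < suc i → m′ ≢ m) → ⊥
    outside m<L m≢1+i ∉arc with All.lookup c-arc (c∈ m<L)
    ... | inj₁ cm≡ = m≢1+i (c-injective m<L 1+i<L cm≡)
    ... | inj₂ (m′ , j≤m′ , m′<1+i , cm′≡) = ∉arc j≤m′ m′<1+i (c-injective (<-trans m′<1+i 1+i<L) m<L cm′≡)
    j-cases : ∀ j → 0 < j ⊎ j ≡ 0
    j-cases zero = inj₂ refl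
    j-cases (suc _) = inj₁ (s≤s z≤n)
    outside-0 : 0 < j → j ≡ prev (suc i) ⊎ j ≡ next (suc i)
    outside-0 0<j = ⊥-elim (outside (<-trans (s≤s z≤n) 1+i<L) (λ ()) λ { j≤m′ _ refl → <⇒≱ 0<j j≤m′ })
    outside-last : j ≡ 0 → j ≡ prev (suc i) ⊎ j ≡ next (suc i)
    outside-last refl with next-cases 1+i<L
    ... | inj₂ (_ , e) = inj₂ (sym e)
    ... | inj₁ (2+i<L , _) = ⊥-elim (outside 2+i<L (λ ()) λ { _ m′<1+i refl → <⇒≱ m′<1+i (n≤1+n _) })

  chordless : ∀ {i j} → i < L → j < L → Adj G (c i) (c j) → j ≡ next i ⊎ j ≡ prev i
  chordless {i} {j} i<L j<L ci~cj with <-cmp i j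
  ... | tri≈ _ refl _ = ⊥-elim (Adj-irrefl ci~cj refl)
  ... | tri> _ _ j<i = [ inj₂ , inj₁ ] (chord-below j<i i<L ci~cj)
  ... | tri< i<j _ _ with chord-below i<j j<L (Adj-sym ci~cj)
  ...   | inj₁ i≡prev-j = inj₁ (trans (sym (next-prev j<L)) (cong next (sym i≡prev-j)))
  ...   | inj₂ i≡next-j = inj₂ (trans (sym (prev-next j<L)) (cong prev (sym i≡next-j)))

-- The colour of position 0 recurs at most at position L ∸ 3, and the pair (3, L ∸ 3) is not
-- mirrored, so no non-trivial rotation or reflection of the cycle preserves a.
record RigidPattern (L : ℕ) (a : ℕ → ℕ) : Set where
  field
    a-suc≢ : ∀ {i} → suc i < L → a i ≢ a (suc i)
    a≢a₀ : ∀ {i} → 0 < i → i < L → i ≢ L ∸ 3 → a i ≢ a 0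
    a[L∸3]≢a₃ : a (L ∸ 3) ≢ a 3

module _ {L : ℕ} where
  open Cyclic L

  prev³0≡L∸3 : 7 ≤ L → prev (prev (prev 0)) ≡ L ∸ 3
  prev³0≡L∸3 (s≤s (s≤s (s≤s (s≤s (s≤s (s≤s (s≤s _))))))) = refl

  prev³[L∸3]≡L∸6 : 7 ≤ L → prev (prev (prev (L ∸ 3))) ≡ L ∸ 6
  prev³[L∸3]≡L∸6 (s≤s (s≤s (s≤s (s≤s (s≤s (s≤s (s≤s _))))))) = refl

  prev0≡1+[L∸2] : 7 ≤ L → prev 0 ≡ suc (L ∸ 2)
  prev0≡1+[L∸2] (s≤s (s≤s (s≤s (s≤s (s≤s (s≤s (s≤s _))))))) = refl

  next[L∸3]≡L∸2 : 7 ≤ L → next (L ∸ 3) ≡ L ∸ 2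
  next[L∸3]≡L∸2 (s≤s (s≤s (s≤s (s≤s (s≤s (s≤s (s≤s _))))))) = next≡suc (n≤1+n _)

  next³0≡3 : 7 ≤ L → next (next (next 0)) ≡ 3
  next³0≡3 7≤L
    rewrite next≡suc {0} (≤-trans (s≤s (s≤s z≤n)) 7≤L)
          | next≡suc {1} (≤-trans (s≤s (s≤s (s≤s z≤n))) 7≤L)
          | next≡suc {2} (≤-trans (s≤s (s≤s (s≤s (s≤s z≤n)))) 7≤L) = refl

  0<L∸6 : 7 ≤ L → 0 < L ∸ 6
  0<L∸6 (s≤s (s≤s (s≤s (s≤s (s≤s (s≤s (s≤s _))))))) = s≤s z≤n

  L∸6≢L∸3 : 7 ≤ L → L ∸ 6 ≢ L ∸ 3
  L∸6≢L∸3 (s≤s (s≤s (s≤s (s≤s (s≤s (s≤s (s≤s _))))))) = λ ()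

  pred-L≢L∸3 : 7 ≤ L → pred L ≢ L ∸ 3
  pred-L≢L∸3 (s≤s (s≤s (s≤s (s≤s (s≤s (s≤s (s≤s _))))))) = λ ()

  L∸3<L : 7 ≤ L → L ∸ 3 < L
  L∸3<L 7≤L = ∸-monoʳ-< (s≤s z≤n) (≤-trans (s≤s (s≤s (s≤s z≤n))) 7≤L)

  L∸3≡1+[L∸4] : 7 ≤ L → L ∸ 3 ≡ suc (L ∸ 4)
  L∸3≡1+[L∸4] (s≤s (s≤s (s≤s (s≤s (s≤s (s≤s (s≤s _))))))) = refl

module _ {L : ℕ} {a : ℕ → ℕ} (rigid : RigidPattern L a) (7≤L : 7 ≤ L) where
  open Cyclic L
  open RigidPattern rigid

  a-next≢ : ∀ {i} → i < L → a i ≢ a (next i)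
  a-next≢ i<L with next-cases i<L
  ... | inj₁ (1+i<L , e) rewrite e = a-suc≢ 1+i<L
  ... | inj₂ (refl , e) rewrite e = a≢a₀ (≤-pred (≤-trans (s≤s (s≤s z≤n)) 7≤L)) i<L (pred-L≢L∸3 7≤L)

  a-prev≢ : ∀ {i} → i < L → a i ≢ a (prev i)
  a-prev≢ i<L e = a-next≢ (prev<L i<L) (trans (sym e) (cong a (sym (next-prev i<L))))

module ListPattern (L : ℕ) (7≤L : 7 ≤ L) (ℓ : ℕ → List ℕ)
                   (ℓ-ok : ∀ {i} → i < L → Unique (ℓ i) × 3 ≤ length (ℓ i)) where

  s : ℕ
  s = L ∸ 3

  3<s : 3 < s
  3<s = ∸-monoˡ-≤ 3 7≤L

  s<L : s < L
  s<L = L∸3<L 7≤L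

  pick-ℓ : ∀ {i} avoid → i < L → length avoid < 3 → pick (ℓ i) avoid ∈ ℓ i × pick (ℓ i) avoid ∉ avoid
  pick-ℓ avoid i<L avoid<3 = pick-spec (proj₁ (ℓ-ok i<L)) (≤-trans avoid<3 (proj₂ (ℓ-ok i<L)))

  two<3 : 2 < 3
  two<3 = ≤-refl

  y : ℕ
  y = pick (ℓ 0) []

  -- a agrees with greedy below s; twin refers to greedy 3 rather than a 3 so that a is
  -- structurally recursive.
  greedy : ℕ → ℕ
  greedy zero = y
  greedy (suc i) = pick (ℓ (suc i)) (y ∷ greedy i ∷ [])

  -- Three colours need not suffice to avoid y, the predecessor and a 3; if y is in the list of s it
  -- is reused there, and otherwise avoiding y is automatic.
  twin : ℕ → ℕ
  twin p with y ∈ℕ? ℓ s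
  ... | yes _ = y
  ... | no _ = pick (ℓ s) (p ∷ greedy 3 ∷ [])

  a : ℕ → ℕ
  a zero = y
  a (suc i) with suc i ≟ s
  ... | yes _ = twin (a i)
  ... | no _ = pick (ℓ (suc i)) (y ∷ a i ∷ [])

  a-regular : ∀ {i} → suc i ≢ s → a (suc i) ≡ pick (ℓ (suc i)) (y ∷ a i ∷ [])
  a-regular {i} 1+i≢s with suc i ≟ s
  ... | yes 1+i≡s = contradiction 1+i≡s 1+i≢s
  ... | no _ = refl

  a-twin : ∀ {i} → suc i ≡ s → a (suc i) ≡ twin (a i)
  a-twin {i} 1+i≡s with suc i ≟ s
  ... | yes _ = refl
  ... | no 1+i≢s = contradiction 1+i≡s 1+i≢s

  a≡greedy : ∀ {i} → i < s → a i ≡ greedy i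
  a≡greedy {zero} _ = refl
  a≡greedy {suc i} 1+i<s =
    trans (a-regular (<⇒≢ 1+i<s)) (cong (λ p → pick (ℓ (suc i)) (y ∷ p ∷ [])) (a≡greedy (<⇒≤ 1+i<s)))

  a≢y : ∀ {i} → 0 < i → i < L → i ≢ s → a i ≢ y
  a≢y {suc i} _ i<L i≢s a≡y = proj₂ (pick-ℓ _ i<L two<3) (here (trans (sym (a-regular i≢s)) a≡y))

  twin∈ℓ : ∀ p → twin p ∈ ℓ s
  twin∈ℓ p with y ∈ℕ? ℓ s
  ... | yes y∈ = y∈
  ... | no _ = proj₁ (pick-ℓ _ s<L two<3)

  twin≢ : ∀ p → p ≢ y → twin p ≢ p
  twin≢ p p≢y with y ∈ℕ? ℓ s
  ... | yes _ = p≢y ∘ sym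
  ... | no _ = proj₂ (pick-ℓ _ s<L two<3) ∘ here

  twin≢a₃ : ∀ p → twin p ≢ a 3
  twin≢a₃ p with y ∈ℕ? ℓ s
  ... | yes _ = a≢y (s≤s z≤n) (<-trans 3<s s<L) (<⇒≢ 3<s) ∘ sym
  ... | no _ = λ e → proj₂ (pick-ℓ _ s<L two<3) (there (here (trans e (a≡greedy 3<s))))

  a∈ℓ : ∀ {i} → i < L → a i ∈ ℓ i
  a∈ℓ {zero} 0<L = proj₁ (pick-ℓ [] 0<L (s≤s z≤n))
  a∈ℓ {suc i} 1+i<L with suc i ≟ s
  ... | no _ = proj₁ (pick-ℓ _ 1+i<L two<3)
  ... | yes 1+i≡s = subst (λ k → twin (a i) ∈ ℓ k) (sym 1+i≡s) (twin∈ℓ (a i))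

  a-suc≢ : ∀ {i} → suc i < L → a i ≢ a (suc i)
  a-suc≢ {i} 1+i<L with suc i ≟ s
  ... | no _ = λ e → proj₂ (pick-ℓ _ 1+i<L two<3) (there (here (sym e)))
  ... | yes 1+i≡s = λ e → twin≢ (a i) (a≢y 0<i (<⇒≤ 1+i<L) i≢s) (sym e)
    where
    0<i : 0 < i
    0<i = ≤-pred (≤-trans (s≤s (s≤s z≤n)) (subst (3 <_) (sym 1+i≡s) 3<s))
    i≢s : i ≢ s
    i≢s i≡s = 1+n≢n (trans 1+i≡s (sym i≡s))

  a[s]≢a₃ : a s ≢ a 3
  a[s]≢a₃ = subst (λ k → a k ≢ a 3) (sym s≡1+[L∸4]) (twin≢a₃ (a (L ∸ 4)) ∘ trans (sym (a-twin (sym s≡1+[L∸4]))))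
    where s≡1+[L∸4] = L∸3≡1+[L∸4] 7≤L

  pattern-rigid : RigidPattern L a
  pattern-rigid = record { a-suc≢ = a-suc≢ ; a≢a₀ = a≢y ; a[L∸3]≢a₃ = a[s]≢a₃ }

data Direction : Set where
  forward backward : Direction

module CycleSymmetry {n : ℕ} {G : Graph n} (C : Cycle G) (uc : UniqueCycle G C) (σ : Automorphism G) where
  open OnCycle C

  move : Direction → ℕ → ℕ
  move forward = next
  move backward = prev

  move<L : ∀ d {i} → i < L → move d i < L
  move<L forward = next<L
  move<L backward = prev<L

  move²≢id : ∀ d {i} → i < L → move d (move d i) ≢ i
  move²≢id forward = next²≢id (long C)
  move²≢id backward = prev²≢id (long C)

  move-edge : ∀ d {i} → i < L → CycleEdge G C (c i) (c (move d i))
  move-edge forward = cycle-edge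
  move-edge backward = cycle-edge′

  _↦_ : ℕ → ℕ → Set
  i ↦ p = φ σ (c i) ≡ c p

  image-on-cycle : ∀ {i} → i < L → ∃ λ p → p < L × i ↦ p
  image-on-cycle i<L with ∈⇒c (cycle-edge⇒∈ (automorphism-preserves-unique-cycle C uc σ (cycle-edge i<L)))
  ... | p , p<L , e = p , p<L , sym e

  image-move : ∀ d {i p} → i < L → p < L → i ↦ p → move d i ↦ next p ⊎ move d i ↦ prev p
  image-move d i<L p<L i↦p =
    cycle-edge-neighbour p<L (subst (λ x → CycleEdge G C x _) i↦p (automorphism-preserves-unique-cycle C uc σ (move-edge d i<L)))

  no-backtrack : ∀ d {i p} → i < L → i ↦ p → ¬ (move d (move d i) ↦ p)
  no-backtrack d i<L i↦p ddi↦p =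
    move²≢id d i<L (c-injective (move<L d (move<L d i<L)) i<L (φ-injective σ (trans ddi↦p (sym i↦p))))

  propagate : ∀ d e {i p} → i < L → p < L → i ↦ p → move d i ↦ move e p → move d (move d i) ↦ move e (move e p)
  propagate d forward {p = p} i<L p<L i↦p di↦ep with image-move d (move<L d i<L) (next<L p<L) di↦ep
  ... | inj₁ r = r
  ... | inj₂ r = ⊥-elim (no-backtrack d {p = p} i<L i↦p (trans r (cong c (prev-next p<L))))
  propagate d backward {p = p} i<L p<L i↦p di↦ep with image-move d (move<L d i<L) (prev<L p<L) di↦ep
  ... | inj₁ r = ⊥-elim (no-backtrack d {p = p} i<L i↦p (trans r (cong c (next-prev p<L))))
  ... | inj₂ r = r

  module _ {a : ℕ → ℕ} (rigid : RigidPattern L a) (7≤L : 7 ≤ L)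
           (g : Fin n → ℕ) (g-c : ∀ {i} → i < L → g (c i) ≡ a i) (g∘σ : ∀ v → g (φ σ v) ≡ g v) where
    open RigidPattern rigid

    0<L : 0 < L
    0<L = ≤-trans (s≤s z≤n) 7≤L

    s : ℕ
    s = L ∸ 3

    s<L : s < L
    s<L = L∸3<L 7≤L

    ↦-colour : ∀ {i p} → i < L → p < L → i ↦ p → a p ≡ a i
    ↦-colour {i} {p} i<L p<L i↦p = begin
      a p             ≡⟨ sym (g-c p<L) ⟩
      g (c p)         ≡⟨ cong g (sym i↦p) ⟩
      g (φ σ (c i))   ≡⟨ g∘σ (c i) ⟩
      g (c i)         ≡⟨ g-c i<L ⟩
      a i             ∎
      where open ≡-Reasoning

    rotation-free : 0 ↦ 0 → 1 ↦ 1 → ∀ {i} → i < L → i ↦ i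
    rotation-free 0↦0 1↦1 {zero} _ = 0↦0
    rotation-free 0↦0 1↦1 {suc i} 1+i<L = proj₂ (consecutive i 1+i<L)
      where
      consecutive : ∀ i → suc i < L → i ↦ i × suc i ↦ suc i
      consecutive zero _ = 0↦0 , 1↦1
      consecutive (suc i) 2+i<L with consecutive i (<⇒≤ 2+i<L)
      ... | i↦i , 1+i↦1+i =
        1+i↦1+i , subst₂ _↦_ e₂ e₂ (propagate forward forward i<L i<L i↦i (subst₂ _↦_ (sym e₁) (sym e₁) 1+i↦1+i))
        where
        i<L : i < L
        i<L = <⇒≤ (<⇒≤ 2+i<L)
        e₁ : next i ≡ suc i
        e₁ = next≡suc (<⇒≤ 2+i<L)
        e₂ : next (next i) ≡ suc (suc i)
        e₂ = trans (cong next e₁) (next≡suc 2+i<L)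

    reflection-impossible : 0 ↦ 0 → ¬ (next 0 ↦ prev 0)
    reflection-impossible 0↦0 1↦prev0 =
      a[L∸3]≢a₃ (subst₂ (λ i p → a p ≡ a i) (next³0≡3 7≤L) (prev³0≡L∸3 7≤L)
                  (↦-colour next³0<L prev³0<L 3↦L∸3))
      where
      next³0<L = next<L (next<L (next<L 0<L))
      prev³0<L = prev<L (prev<L (prev<L 0<L))
      3↦L∸3 : next (next (next 0)) ↦ prev (prev (prev 0))
      3↦L∸3 = propagate forward backward (next<L 0<L) (prev<L 0<L) 1↦prev0
                (propagate forward backward 0<L 0<L 0↦0 1↦prev0)

    twin-impossible : ¬ (0 ↦ s)
    twin-impossible 0↦s with image-move backward 0<L s<L 0↦s
    ... | inj₁ prev0↦next-s =
      a-suc≢ (subst (_< L) (prev0≡1+[L∸2] 7≤L) (prev<L 0<L))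
        (subst₂ (λ i p → a p ≡ a i) (prev0≡1+[L∸2] 7≤L) (next[L∸3]≡L∸2 7≤L)
          (↦-colour (prev<L 0<L) (next<L s<L) prev0↦next-s))
    ... | inj₂ prev0↦prev-s = a≢a₀ (0<L∸6 7≤L) L∸6<L (L∸6≢L∸3 7≤L) (begin
      a (L ∸ 6)                   ≡⟨ cong a (sym (prev³[L∸3]≡L∸6 7≤L)) ⟩
      a (prev (prev (prev s)))    ≡⟨ ↦-colour prev³0<L prev³s<L prev³0↦prev³s ⟩
      a (prev (prev (prev 0)))    ≡⟨ cong a (prev³0≡L∸3 7≤L) ⟩
      a s                         ≡⟨ ↦-colour 0<L s<L 0↦s ⟩
      a 0                         ∎)
      where
      open ≡-Reasoning
      prev³0<L = prev<L (prev<L (prev<L 0<L))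
      prev³s<L = prev<L (prev<L (prev<L s<L))
      L∸6<L = subst (_< L) (prev³[L∸3]≡L∸6 7≤L) prev³s<L
      prev³0↦prev³s : prev (prev (prev 0)) ↦ prev (prev (prev s))
      prev³0↦prev³s = propagate backward backward (prev<L 0<L) (prev<L s<L) prev0↦prev-s
                        (propagate backward backward 0<L s<L 0↦s prev0↦prev-s)

    cycle-fixed : ∀ {i} → i < L → i ↦ i
    cycle-fixed i<L with image-on-cycle 0<L
    ... | k , k<L , 0↦k with k ≟ 0 | k ≟ s
    ... | no _ | yes refl = ⊥-elim (twin-impossible 0↦k)
    ... | no k≢0 | no k≢s = ⊥-elim (a≢a₀ (n≢0⇒n>0 k≢0) k<L k≢s (↦-colour 0<L k<L 0↦k))
    ... | yes refl | _ with image-move forward 0<L 0<L 0↦k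
    ...   | inj₁ 1↦1 = rotation-free 0↦k (subst₂ _↦_ next0≡1 next0≡1 1↦1) i<L
      where next0≡1 = next≡suc (≤-trans (s≤s (s≤s z≤n)) 7≤L)
    ...   | inj₂ 1↦prev0 = ⊥-elim (reflection-impossible 0↦k 1↦prev0)

∈⇒≤foldr-⊔ : ∀ {x xs} → x ∈ xs → x ≤ foldr _⊔_ 0 xs
∈⇒≤foldr-⊔ {xs = y ∷ ys} (here refl) = m≤m⊔n y _
∈⇒≤foldr-⊔ {xs = y ∷ ys} (there x∈) = ≤-trans (∈⇒≤foldr-⊔ x∈) (m≤n⊔m y _)

module Neighbours {n : ℕ} (G : Graph n) where

  neighbours : Fin n → List (Fin n)
  neighbours u = filter (λ x → T? (adj G u x)) (allFin n)

  Adj⇒∈neighbours : ∀ {u x} → Adj G u x → x ∈ neighbours u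
  Adj⇒∈neighbours {u} {x} ux = ∈-filter⁺ (λ x → T? (adj G u x)) (∈-allFin x) (Equivalence.from T-≡ ux)

  degree≤maxDegree : ∀ u → degree G u ≤ maxDegree G
  degree≤maxDegree u = ∈⇒≤foldr-⊔ (∈-map⁺ (degree G) (∈-allFin u))

module Attachments {n : ℕ} {G : Graph n} (C : Cycle G) (uc : UniqueCycle G C) where
  open OnCycle C
  open Walks G
  open OnUniqueCycle C uc
  open Neighbours G
  open DecMembership (Fin._≟_ {n}) using () renaming (_∈?_ to _∈ⱽ?_)

  dom : List (Fin n × Fin n) → List (Fin n)
  dom = map proj₁

  reached : List (Fin n × Fin n) → List (Fin n)
  reached T = dom T ++ vertices

  -- Pairs (vertex , parent), most recently attached first.
  data Attached : List (Fin n × Fin n) → Set where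
    [] : Attached []
    attach : ∀ {T w u} → w ∉ reached T → u ∈ reached T → Adj G u w →
             (∀ {x} → x ∈ reached T → Adj G x w → x ≡ u) → Attached T → Attached ((w , u) ∷ T)

  cycle⊆reached : ∀ {T x} → x ∈ vertices → x ∈ reached T
  cycle⊆reached {T} = ∈-++⁺ʳ (dom T)

  child-reached : ∀ {T v p} → (v , p) ∈ T → v ∈ reached T
  child-reached = ∈-++⁺ˡ ∘ ∈-map⁺ proj₁

  parent-reached : ∀ {T v p} → Attached T → (v , p) ∈ T → p ∈ reached T × Adj G p v
  parent-reached (attach _ u∈ uw _ _) (here refl) = there u∈ , uw
  parent-reached (attach _ _ _ _ at) (there vp∈) with parent-reached at vp∈
  ... | p∈ , pv = there p∈ , pv

  dom∌cycle : ∀ {T x} → Attached T → x ∈ dom T → x ∉ vertices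
  dom∌cycle (attach w∉ _ _ _ _) (here refl) = w∉ ∘ cycle⊆reached
  dom∌cycle (attach _ _ _ _ at) (there x∈) = dom∌cycle at x∈

  dom-unique : ∀ {T} → Attached T → Unique (dom T)
  dom-unique [] = []
  dom-unique (attach w∉ _ _ _ at) = ¬Any⇒All¬ _ (w∉ ∘ ∈-++⁺ˡ) ∷ dom-unique at

  reached-unique : ∀ {T} → Attached T → Unique (reached T)
  reached-unique [] = uniq C
  reached-unique (attach w∉ _ _ _ at) = ¬Any⇒All¬ _ w∉ ∷ reached-unique at

  no-mutual-parents : ∀ {T u p} → Attached T → (u , p) ∈ T → (p , u) ∉ T
  no-mutual-parents (attach _ _ uw _ _) (here refl) (here refl) = Adj-irrefl uw refl
  no-mutual-parents (attach w∉ _ _ _ at) (here refl) (there uw∈) = w∉ (proj₁ (parent-reached at uw∈))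
  no-mutual-parents (attach w∉ _ _ _ at) (there uw∈) (here refl) = w∉ (proj₁ (parent-reached at uw∈))
  no-mutual-parents (attach _ _ _ _ at) (there up∈) (there pu∈) = no-mutual-parents at up∈ pu∈

  walk-from-start : ∀ {T x} → Attached T → x ∈ reached T → WalkIn (_∈ reached T) (c 0) x
  walk-from-start [] x∈ with ∈⇒c x∈
  ... | i , i<L , refl = WalkIn-map (λ { (m , _ , m<L , refl) → c∈ m<L }) (arc-walk i z≤n i<L ≤-refl)
  walk-from-start (attach _ u∈ uw _ at) (here refl) = WalkIn-snoc (WalkIn-map there (walk-from-start at u∈)) uw (here refl)
  walk-from-start (attach _ _ _ _ at) (there x∈) = WalkIn-map there (walk-from-start at x∈)

  parent-unique : ∀ {T w u} → Attached T → w ∉ reached T → u ∈ reached T → Adj G u w →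
                  ∀ {x} → x ∈ reached T → Adj G x w → x ≡ u
  parent-unique {u = u} at w∉ u∈ uw {x} x∈ xw with x Fin.≟ u
  ... | yes x≡u = x≡u
  ... | no x≢u = contradiction (cycle⊆reached w∈C) w∉
    where
    u~x = WalkIn-++ (WalkIn-reverse (walk-from-start at u∈)) (walk-from-start at x∈)
    w∈C = proj₁ (unique-cycle-through C uc u~x w∉ (Adj-sym uw) (Adj-sym xw) (x≢u ∘ sym))

  children : Fin n → List (Fin n × Fin n) → List (Fin n)
  children u T = dom (filter (λ e → proj₂ e Fin.≟ u) T)

  ∈-children⁻ : ∀ {u T x} → x ∈ children u T → (x , u) ∈ T
  ∈-children⁻ {u} x∈ with ∈-map⁻ proj₁ x∈
  ... | _ , e∈ , refl with ∈-filter⁻ (λ e → proj₂ e Fin.≟ u) e∈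
  ...   | e∈T , refl = e∈T

  ∈-children⁺ : ∀ {u T x} → (x , u) ∈ T → x ∈ children u T
  ∈-children⁺ {u} xu∈ = ∈-map⁺ proj₁ (∈-filter⁺ (λ e → proj₂ e Fin.≟ u) xu∈ refl)

  children-unique : ∀ {u T} → Attached T → Unique (children u T)
  children-unique {u} at = AllPairs.map⁺ (AllPairs.filter⁺ (λ e → proj₂ e Fin.≟ u) (AllPairs.map⁻ (dom-unique at)))

  other-neighbour : ∀ {T u} → Attached T → u ∈ reached T → ∃ λ e → Adj G u e × e ∈ reached T × e ∉ children u T
  other-neighbour {T} at u∈ with ∈-++⁻ (dom T) u∈
  ... | inj₂ u∈C with ∈⇒c u∈C
  ...   | i , i<L , refl = c (next i) , CycleEdge⇒Adj (cycle-edge i<L) , cycle⊆reached (c∈ (next<L i<L)) ,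
                             λ e∈ → dom∌cycle at (∈-map⁺ proj₁ (∈-children⁻ e∈)) (c∈ (next<L i<L))
  other-neighbour at u∈ | inj₁ u∈dom with ∈-map⁻ proj₁ u∈dom
  ... | _ , up∈ , refl = _ , Adj-sym (proj₂ (parent-reached at up∈)) , proj₁ (parent-reached at up∈) ,
                         no-mutual-parents at up∈ ∘ ∈-children⁻

  2+children≤degree : ∀ {T w u} → Attached T → w ∉ reached T → u ∈ reached T → Adj G u w →
                      suc (suc (length (children u T))) ≤ degree G u
  2+children≤degree at w∉ u∈ uw with other-neighbour at u∈
  ... | e , ue , e∈ , e∉ =
    Unique-⊆-∉⇒length< Fin._≟_ (¬Any⇒All¬ _ e∉ ∷ children-unique at)
      (λ { (here refl) → Adj⇒∈neighbours ue
         ; (there x∈) → Adj⇒∈neighbours (proj₂ (parent-reached at (∈-children⁻ x∈))) })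
      (Adj⇒∈neighbours uw)
      (λ { (here refl) → w∉ e∈ ; (there w∈) → w∉ (child-reached (∈-children⁻ w∈)) })

  edge-leaving? : (X : List (Fin n)) → Dec (∃₂ λ u w → u ∈ X × w ∉ X × Adj G u w)
  edge-leaving? X = Fin.any? λ u → Fin.any? λ w → (u ∈ⱽ? X) ×-dec (¬? (w ∈ⱽ? X)) ×-dec (adj G u w Bool.≟ true)

  walk-stays-in : ∀ {X : List (Fin n)} → ¬ (∃₂ λ u w → u ∈ X × w ∉ X × Adj G u w) →
                ∀ {x y} → Walk G x y → x ∈ X → y ∈ X
  walk-stays-in ¬leaving [] x∈ = x∈
  walk-stays-in {X} ¬leaving (_∷_ {w = w} xw walk) x∈ =
    walk-stays-in ¬leaving walk (decidable-stable (w ∈ⱽ? X) (λ w∉ → ¬leaving (_ , w , x∈ , w∉ , xw)))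

  grow : Connected G → ∀ fuel {T} → Attached T → n ≤ length (reached T) + fuel →
         ∃ λ T′ → Attached T′ × (∀ v → v ∈ reached T′)
  grow conn fuel {T} at n≤ with edge-leaving? (reached T)
  ... | no ¬leaving = T , at , λ v → walk-stays-in ¬leaving (conn (c 0) v) (cycle⊆reached (c∈ (≤-trans (s≤s z≤n) (long C))))
  ... | yes (u , w , u∈ , w∉ , uw) with fuel
  ...   | zero = contradiction (subst (n ≤_) (+-identityʳ _) n≤) (<⇒≱ reached<n)
    where
    reached<n : length (reached T) < n
    reached<n = subst (length (reached T) <_) (length-tabulate (λ i → i))
      (Unique-⊆-∉⇒length< Fin._≟_ (reached-unique at) (λ {x} _ → ∈-allFin x) (∈-allFin w) w∉)
  ...   | suc fuel = grow conn fuel (attach w∉ u∈ uw (parent-unique at w∉ u∈ uw) at) (subst (n ≤_) (+-suc _ fuel) n≤)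

  spanning-attachment : Connected G → ∃ λ T → Attached T × (∀ v → v ∈ reached T)
  spanning-attachment conn = grow conn n [] (m≤n+m n L)

  Fresh : (Fin n → ℕ) → ∀ {T} → Attached T → Set
  Fresh f [] = ⊤
  Fresh f (attach {T} {w} {u} _ _ _ _ at) = f w ≢ f u × (∀ {v} → (v , u) ∈ T → f w ≢ f v) × Fresh f at

  Fresh-cong : ∀ {f g T} (at : Attached T) → (∀ {x} → x ∈ reached T → f x ≡ g x) → Fresh f at → Fresh g at
  Fresh-cong [] _ _ = tt
  Fresh-cong (attach _ u∈ _ _ at) f≗g (fw≢fu , fw≢siblings , fresh) =
    (λ e → fw≢fu (trans (f≗g (here refl)) (trans e (sym (f≗g (there u∈)))))) ,
    (λ vu∈ e → fw≢siblings vu∈ (trans (f≗g (here refl)) (trans e (sym (f≗g (there (child-reached vu∈))))))) ,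
    Fresh-cong at (f≗g ∘ there) fresh

  Fresh⇒proper : ∀ {f T} (at : Attached T) → Fresh f at →
                 (∀ {i j} → i < L → j < L → Adj G (c i) (c j) → f (c i) ≢ f (c j)) →
                 ∀ {x y} → x ∈ reached T → y ∈ reached T → Adj G x y → f x ≢ f y
  Fresh⇒proper [] _ cycle-proper x∈ y∈ xy with ∈⇒c x∈ | ∈⇒c y∈
  ... | i , i<L , refl | j , j<L , refl = cycle-proper i<L j<L xy
  Fresh⇒proper (attach _ _ _ _ _) _ _ (here refl) (here refl) xy = ⊥-elim (Adj-irrefl xy refl)
  Fresh⇒proper (attach _ _ _ unique _) (fw≢fu , _) _ (here refl) (there y∈) xy rewrite unique y∈ (Adj-sym xy) = fw≢fu
  Fresh⇒proper (attach _ _ _ unique _) (fw≢fu , _) _ (there x∈) (here refl) xy rewrite unique x∈ xy = fw≢fu ∘ sym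
  Fresh⇒proper (attach _ _ _ _ at) (_ , _ , fresh) cycle-proper (there x∈) (there y∈) =
    Fresh⇒proper at fresh cycle-proper x∈ y∈

  module _ (σ : Automorphism G) {f : Fin n → ℕ} (f∘σ : ∀ v → f (φ σ v) ≡ f v)
           (cycle-fixed : ∀ {x} → x ∈ vertices → φ σ x ≡ x) where

    -- The induction peels off the most recent vertex; Separated T is what the vertices attached
    -- after T guarantee, and it holds vacuously once T reaches every vertex.
    Separated : List (Fin n × Fin n) → Set
    Separated T = ∀ {v p y} → (v , p) ∈ T → y ∉ reached T → Adj G p y → f y ≢ f v

    Fresh⇒fixed : ∀ {T} (at : Attached T) → Fresh f at → Separated T → ∀ {x} → x ∈ reached T → φ σ x ≡ x
    Fresh⇒fixed [] _ _ = cycle-fixed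
    Fresh⇒fixed (attach {T} {w} {u} w∉ u∈ uw unique at) (fw≢fu , fw≢siblings , fresh) separated = λ
      { (here refl) → σw≡w
      ; (there x∈) → fixed x∈ }
      where
      separated′ : Separated T
      separated′ {v} {p} {y} vp∈ y∉ py with y Fin.≟ w
      ... | no y≢w = separated (there vp∈) (λ { (here y≡w) → y≢w y≡w ; (there y∈) → y∉ y∈ }) py
      ... | yes refl = fw≢siblings (subst (λ q → (v , q) ∈ T) (unique (proj₁ (parent-reached at vp∈)) py) vp∈)
      fixed : ∀ {x} → x ∈ reached T → φ σ x ≡ x
      fixed = Fresh⇒fixed at fresh separated′
      u~σw : Adj G u (φ σ w)
      u~σw = trans (cong (λ z → adj G z (φ σ w)) (sym (fixed u∈))) (trans (pres σ u w) uw)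
      σw≡w : φ σ w ≡ w
      σw≡w with φ σ w ∈ⱽ? reached T | φ σ w Fin.≟ w
      ... | yes σw∈ | _ = φ-injective σ (fixed σw∈)
      ... | no _ | yes σw≡w = σw≡w
      ... | no σw∉ | no σw≢w =
        contradiction (f∘σ w) (separated (here refl) (λ { (here e) → σw≢w e ; (there σw∈) → σw∉ σw∈ }) u~σw)

module ListColouring {n : ℕ} {G : Graph n} (conn : Connected G) (C : Cycle G) (uc : UniqueCycle G C)
                     (7≤L : 7 ≤ cycleLength G C) (3≤Δ : 3 ≤ maxDegree G)
                     (Lst : Fin n → List ℕ) (Lst-ok : ∀ v → Unique (Lst v) × length (Lst v) ≡ maxDegree G) where
  open OnCycle C
  open Neighbours G
  open Attachments C uc
  open OnUniqueCycle C uc using (chordless)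
  open DecMembership (Fin._≟_ {n}) using () renaming (_∈?_ to _∈ⱽ?_)

  Lst-unique : ∀ v → Unique (Lst v)
  Lst-unique v = proj₁ (Lst-ok v)

  Δ≡|Lst| : ∀ v → maxDegree G ≡ length (Lst v)
  Δ≡|Lst| v = sym (proj₂ (Lst-ok v))

  open ListPattern L 7≤L (Lst ∘ c) (λ {i} _ → Lst-unique (c i) , subst (3 ≤_) (Δ≡|Lst| (c i)) 3≤Δ)
    using (a; a∈ℓ; pattern-rigid)

  cycle-colouring : Fin n → ℕ
  cycle-colouring x with x ∈ⱽ? vertices
  ... | yes x∈ = a (proj₁ (∈⇒c x∈))
  ... | no _ = 0

  cycle-colouring-c : ∀ {i} → i < L → cycle-colouring (c i) ≡ a i
  cycle-colouring-c {i} i<L with c i ∈ⱽ? vertices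
  ... | no ci∉ = contradiction (c∈ i<L) ci∉
  ... | yes ci∈ with ∈⇒c ci∈
  ...   | j , j<L , cj≡ci = cong a (c-injective j<L i<L cj≡ci)

  forbidden : (Fin n → ℕ) → Fin n → List (Fin n × Fin n) → List ℕ
  forbidden f u T = f u ∷ map f (children u T)

  colouring : ∀ {T} → Attached T → Fin n → ℕ
  colouring [] = cycle-colouring
  colouring (attach {T} {w} {u} _ _ _ _ at) x with x Fin.≟ w
  ... | yes _ = pick (Lst w) (forbidden (colouring at) u T)
  ... | no _ = colouring at x

  previous : ∀ {T e} → Attached (e ∷ T) → Attached T
  previous (attach _ _ _ _ at) = at

  colouring-new : ∀ {T w u} (at : Attached ((w , u) ∷ T)) →
                  colouring at w ≡ pick (Lst w) (forbidden (colouring (previous at)) u T)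
  colouring-new {w = w} (attach _ _ _ _ _) with w Fin.≟ w
  ... | yes _ = refl
  ... | no w≢w = contradiction refl w≢w

  colouring-old : ∀ {T w u} (at : Attached ((w , u) ∷ T)) → ∀ {x} → x ∈ reached T →
                  colouring at x ≡ colouring (previous at) x
  colouring-old {w = w} (attach w∉ _ _ _ _) {x} x∈ with x Fin.≟ w
  ... | yes refl = contradiction x∈ w∉
  ... | no _ = refl

  new-colour-spec : ∀ {T w u} (at : Attached T) → w ∉ reached T → u ∈ reached T → Adj G u w →
                    let col = pick (Lst w) (forbidden (colouring at) u T) in col ∈ Lst w × col ∉ forbidden (colouring at) u T
  new-colour-spec {T} {w} {u} at w∉ u∈ uw = pick-spec (Lst-unique w) (begin-strict
    length (forbidden (colouring at) u T)  ≡⟨ cong suc (length-map (colouring at) (children u T)) ⟩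
    suc (length (children u T))            <⟨ 2+children≤degree at w∉ u∈ uw ⟩
    degree G u                             ≤⟨ degree≤maxDegree u ⟩
    maxDegree G                            ≡⟨ Δ≡|Lst| w ⟩
    length (Lst w)                         ∎)
    where open ≤-Reasoning

  colouring-c : ∀ {T} (at : Attached T) → ∀ {i} → i < L → colouring at (c i) ≡ a i
  colouring-c [] = cycle-colouring-c
  colouring-c at′@(attach _ _ _ _ at) i<L = trans (colouring-old at′ (cycle⊆reached (c∈ i<L))) (colouring-c at i<L)

  colouring-∈ : ∀ {T} (at : Attached T) → ∀ {x} → x ∈ reached T → colouring at x ∈ Lst x
  colouring-∈ [] x∈ with ∈⇒c x∈
  ... | i , i<L , refl = subst (_∈ Lst (c i)) (sym (cycle-colouring-c i<L)) (a∈ℓ i<L)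
  colouring-∈ at′@(attach w∉ u∈ uw _ at) (here refl) =
    subst (_∈ Lst _) (sym (colouring-new at′)) (proj₁ (new-colour-spec at w∉ u∈ uw))
  colouring-∈ at′@(attach _ _ _ _ at) {x} (there x∈) =
    subst (_∈ Lst x) (sym (colouring-old at′ x∈)) (colouring-∈ at x∈)

  colouring-fresh : ∀ {T} (at : Attached T) → Fresh (colouring at) at
  colouring-fresh [] = tt
  colouring-fresh at′@(attach {T} {w} {u} w∉ u∈ uw _ at) =
    new-avoids u∈ (here refl) ,
    (λ vu∈ → new-avoids (child-reached vu∈) (there (∈-map⁺ (colouring at) (∈-children⁺ vu∈)))) ,
    Fresh-cong at (sym ∘ colouring-old at′) (colouring-fresh at)
    where
    new-avoids : ∀ {x} → x ∈ reached T → colouring at x ∈ forbidden (colouring at) u T → colouring at′ w ≢ colouring at′ x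
    new-avoids x∈ fx∈ e = proj₂ (new-colour-spec at w∉ u∈ uw)
      (subst (_∈ forbidden (colouring at) u T) (sym (trans (sym (colouring-new at′)) (trans e (colouring-old at′ x∈)))) fx∈)

  cycle-proper : ∀ {T} (at : Attached T) → ∀ {i j} → i < L → j < L → Adj G (c i) (c j) →
                 colouring at (c i) ≢ colouring at (c j)
  cycle-proper at i<L j<L ci~cj rewrite colouring-c at i<L | colouring-c at j<L with chordless i<L j<L ci~cj
  ... | inj₁ refl = a-next≢ pattern-rigid 7≤L i<L
  ... | inj₂ refl = a-prev≢ pattern-rigid 7≤L i<L

  list-distinguishable : ProperlyLDistinguishable G Lst
  list-distinguishable with spanning-attachment conn
  ... | T , at , all = colouring at , (λ v → colouring-∈ at (all v)) , proper , distinguishing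
    where
    proper : Proper G (colouring at)
    proper u v = Fresh⇒proper at (colouring-fresh at) (cycle-proper at) (all u) (all v)
    distinguishing : Distinguishing G (colouring at)
    distinguishing σ f∘σ v =
      Fresh⇒fixed σ f∘σ cycle-fixed at (colouring-fresh at) (λ _ y∉ _ → contradiction (all _) y∉) (all v)
      where
      cycle-fixed : ∀ {x} → x ∈ vertices → φ σ x ≡ x
      cycle-fixed x∈ with ∈⇒c x∈
      ... | i , i<L , refl = CycleSymmetry.cycle-fixed C uc σ pattern-rigid 7≤L (colouring at) (colouring-c at) f∘σ i<L

mainTheorem2 : ∀ (n : ℕ) (G : Graph n) → Connected G → (C : Cycle G) → UniqueCycle G C
    → 7 ≤ cycleLength G C → 3 ≤ maxDegree G → χDL≤ G (maxDegree G)
mainTheorem2 n G conn C uc 7≤L 3≤Δ =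
  maxDegree G , ≤-refl , λ (Lst , Lst-ok) → ListColouring.list-distinguishable conn C uc 7≤L 3≤Δ Lst Lst-ok
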